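{- Let $M\models Th(\mathbb{N})$. If $x$ is an $M$-real, then there exist a safe formula $\phi(\vec v,i,j)$ and a finite sequence $\vec w$ of elements of $M$ such that $\phi(\vec w,i,j)$ defines $x$ in $M$.
   Context: $\mathfrak{L}_{PA}=\{0,1,+,\cdot,<\}$; pairs and negative integers are coded in a fixed standard way. For $M\models Th(\mathbb{N})$, an $M$-real is a function $M\to(-M\cup M)\times(M\setminus\{0\})$, $i\mapsto(a_i,b_i)$, whose graph is definable in $M$ by an $\mathfrak{L}_{PA}$-formula with parameters from $M$, and which is convergent: for every $m\in M^{>0}$ there is $n\in M$ with $m|a_{k_1}/b_{k_1}-a_{k_2}/b_{k_2}|<1$ for all $k_1,k_2>n$. An $\mathfrak{L}_{PA}$-formula $\phi(\vec v,x,y)$ is safe if $Th(\mathbb{N})$ proves that for every $\vec v$, $\phi(\vec v,x,y)$ defines a total function from numbers to (codes of) pairs with second coordinate $\neq0$ whose associated sequence of fractions is convergent. -}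

module Defs where

open import Data.Nat as ℕ using (ℕ)
open import Data.Fin using (Fin; zero; suc)
open import Data.Product using (Σ; _×_; _,_; proj₁; proj₂)
open import Data.Empty using (⊥)
open import Relation.Binary.PropositionalEquality using (_≡_; _≢_)
open import Function.Bundles using (_⇔_)

-- Syntax of first-order L_PA = {0,1,+,·,<} (well-scoped de Bruijn; a
-- formula in Fm k has its free variables among Fin k).

data Tm (k : ℕ) : Set where
  var  : Fin k → Tm k
  zer  : Tm k
  one  : Tm k
  _⊕_  : Tm k → Tm k → Tm k
  _⊗_  : Tm k → Tm k → Tm k

data Fm (k : ℕ) : Set where
  _≐_  : Tm k → Tm k → Fm k
  _≺_  : Tm k → Tm k → Fm k
  ⊥'   : Fm k
  ¬'_  : Fm k → Fm k
  _∧'_ : Fm k → Fm k → Fm k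
  _∨'_ : Fm k → Fm k → Fm k
  _⇒'_ : Fm k → Fm k → Fm k
  ∀'   : Fm (ℕ.suc k) → Fm k
  ∃'   : Fm (ℕ.suc k) → Fm k

Sentence : Set
Sentence = Fm 0

-- L_PA-structures (equality interpreted as identity).

record Structure : Set₁ where
  field
    Carrier : Set
    𝟘 𝟙     : Carrier
    _+ᴹ_    : Carrier → Carrier → Carrier
    _*ᴹ_    : Carrier → Carrier → Carrier
    _<ᴹ_    : Carrier → Carrier → Set

open Structure public

Env : Structure → ℕ → Set
Env M k = Fin k → Carrier M

extend : (M : Structure) {k : ℕ} → Carrier M → Env M k → Env M (ℕ.suc k)
extend M a ρ zero    = a
extend M a ρ (suc x) = ρ x

evalTm : (M : Structure) {k : ℕ} → Tm k → Env M k → Carrier M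
evalTm M (var x) ρ = ρ x
evalTm M zer ρ = 𝟘 M
evalTm M one ρ = 𝟙 M
evalTm M (s ⊕ t) ρ = _+ᴹ_ M (evalTm M s ρ) (evalTm M t ρ)
evalTm M (s ⊗ t) ρ = _*ᴹ_ M (evalTm M s ρ) (evalTm M t ρ)

Sat : (M : Structure) {k : ℕ} → Fm k → Env M k → Set
Sat M (s ≐ t) ρ = evalTm M s ρ ≡ evalTm M t ρ
Sat M (s ≺ t) ρ = _<ᴹ_ M (evalTm M s ρ) (evalTm M t ρ)
Sat M ⊥' ρ = ⊥
Sat M (¬' φ) ρ = Sat M φ ρ → ⊥
Sat M (φ ∧' ψ) ρ = Sat M φ ρ × Sat M ψ ρ
Sat M (φ ∨' ψ) ρ = Data.Sum._⊎_ (Sat M φ ρ) (Sat M ψ ρ)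
  where import Data.Sum
Sat M (φ ⇒' ψ) ρ = Sat M φ ρ → Sat M ψ ρ
Sat M (∀' φ) ρ = (a : Carrier M) → Sat M φ (extend M a ρ)
Sat M (∃' φ) ρ = Σ (Carrier M) λ a → Sat M φ (extend M a ρ)

ℕS : Structure
ℕS = record
  { Carrier = ℕ ; 𝟘 = 0 ; 𝟙 = 1
  ; _+ᴹ_ = ℕ._+_ ; _*ᴹ_ = ℕ._*_ ; _<ᴹ_ = ℕ._<_ }

emptyEnv : (M : Structure) → Env M 0
emptyEnv M ()

ModelOfTA : Structure → Set
ModelOfTA M = (σ : Sentence) → Sat ℕS σ (emptyEnv ℕS) → Sat M σ (emptyEnv M)

-- Integers of M ("-M ∪ M"):  pos a = a,  negsuc a = -(a+1).

data MInt (A : Set) : Set where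
  pos    : A → MInt A
  negsuc : A → MInt A

module _ (M : Structure) where
  private
    _+_ = _+ᴹ_ M
    _*_ = _*ᴹ_ M
    _<_ = _<ᴹ_ M
  infixl 6 _+_
  infixl 7 _*_
  infix 4 _<_

  -- Fixed standard codings:  a ↦ 2a,  -(a+1) ↦ 2a+1  (i.e. -n ↦ 2n-1),
  -- and Cantor pairing ⟨s,t⟩ = (s+t)(s+t+1)/2 + t.
  intCode : MInt (Carrier M) → Carrier M
  intCode (pos a)    = a + a
  intCode (negsuc a) = a + a + 𝟙 M

  IsPairCode : Carrier M → Carrier M → Carrier M → Set
  IsPairCode s t c = c + c ≡ (s + t) * (s + t + 𝟙 M) + (t + t)

  CodeOf : MInt (Carrier M) × Carrier M → Carrier M → Set
  CodeOf (a , b) c = IsPairCode (intCode a) b c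

  -- positive / negative parts of an M-integer (a = pp a - np a)
  pp np : MInt (Carrier M) → Carrier M
  pp (pos a)    = a
  pp (negsuc a) = 𝟘 M
  np (pos a)    = 𝟘 M
  np (negsuc a) = a + 𝟙 M

  -- m · |a₁/b₁ - a₂/b₂| < 1, for b₁,b₂ ≠ 0, written out in M's semiring:
  -- with U = a₁⁺b₂ + a₂⁻b₁ and V = a₂⁺b₁ + a₁⁻b₂ (so a₁b₂ - a₂b₁ = U - V),
  -- the condition is  mU < mV + b₁b₂  and  mV < mU + b₁b₂.
  Close : Carrier M → MInt (Carrier M) × Carrier M → MInt (Carrier M) × Carrier M → Set
  Close m (a₁ , b₁) (a₂ , b₂) =
    let U = pp a₁ * b₂ + np a₂ * b₁
        V = pp a₂ * b₁ + np a₁ * b₂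
    in (m * U < m * V + b₁ * b₂) × (m * V < m * U + b₁ * b₂)

  Seq : Set
  Seq = Carrier M → MInt (Carrier M) × Carrier M

  NonzeroDen : Seq → Set
  NonzeroDen x = (i : Carrier M) → proj₂ (x i) ≢ 𝟘 M

  Convergent : Seq → Set
  Convergent x = (m : Carrier M) → 𝟘 M < m →
    Σ (Carrier M) λ n → (k₁ k₂ : Carrier M) → n < k₁ → n < k₂ →
      Close m (x k₁) (x k₂)

  -- environment for φ(w⃗, i, j): variable 0 = i, variable 1 = j, then w⃗
  args : {n : ℕ} → (Fin n → Carrier M) → Carrier M → Carrier M → Env M (ℕ.suc (ℕ.suc n))
  args w i j zero          = i
  args w i j (suc zero)    = j
  args w i j (suc (suc k)) = w k

  Defines : {n : ℕ} → Fm (ℕ.suc (ℕ.suc n)) → (Fin n → Carrier M) → Seq → Set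
  Defines φ w x = (i j : Carrier M) → Sat M φ (args w i j) ⇔ CodeOf (x i) j

  Definable : Seq → Set
  Definable x = Σ ℕ λ n → Σ (Fm (ℕ.suc (ℕ.suc n))) λ φ →
                Σ (Fin n → Carrier M) λ w → Defines φ w x

  IsMReal : Seq → Set
  IsMReal x = NonzeroDen x × Definable x × Convergent x

-- φ(v⃗,x,y) is safe: Th(ℕ) proves (equivalently, ℕ satisfies) that for
-- every v⃗, φ(v⃗,·,·) defines a total function to codes of pairs with
-- nonzero second coordinate whose sequence of fractions converges.
Safe : {n : ℕ} → Fm (ℕ.suc (ℕ.suc n)) → Set
Safe {n} φ = (v : Fin n → ℕ) → Σ (Seq ℕS) λ f →
  Defines ℕS φ v f × NonzeroDen ℕS f × Convergent ℕS f

-- Given an M-real x defined by φ(w⃗, i, j), let ψ(v⃗) be the first-order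
-- statement "φ(v⃗, ·, ·) is the graph of a function into codes of pairs with
-- nonzero second coordinate whose fractions converge".  The formula
--   φ̂ := (ψ ∧ φ) ∨ (¬ ψ ∧ "j codes (0, 1)")
-- is safe: for parameters v⃗ in ℕ where ψ holds it defines the same sequence
-- as φ (decoding is possible because pairing is injective in ℕ), and elsewhere
-- the constant sequence 0.  Since x is an M-real, M ⊨ ψ(w⃗), so φ̂(w⃗, ·, ·)
-- still defines x in M; checking M ⊨ ψ(w⃗) only needs that Cantor pairing is
-- total and doubling is injective in M, both true sentences of ℕ.
module Submission where

open import Defs
open import Level using (0ℓ)
open import Axiom.ExcludedMiddle using (ExcludedMiddle)
open import Data.Nat as Nat using (ℕ; zero; suc; z<s)
open import Data.Nat.Properties
open import Data.Nat.Tactic.RingSolver using (solve-∀)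
open import Data.Fin as Fin using (Fin; #_; _↑ʳ_; lift)
open import Data.Product using (Σ; _×_; _,_; proj₁; proj₂)
open import Data.Product.Function.NonDependent.Propositional using (_×-⇔_)
open import Data.Product.Function.Dependent.Propositional using (Σ-⇔)
open import Data.Sum using (_⊎_; inj₁; inj₂)
open import Data.Sum.Function.Propositional using (_⊎-⇔_)
open import Data.Empty using (⊥-elim)
open import Function.Bundles using (_⇔_; mk⇔; Equivalence)
open import Function.Construct.Identity using (↠-id; ⇔-id)
open import Function.Properties.Equivalence using () renaming (trans to ⇔-trans)
open import Function.Related.TypeIsomorphisms using (→-cong-⇔; ¬-cong-⇔)
open import Relation.Binary using (tri<; tri≈; tri>)
open import Relation.Binary.PropositionalEquality
open import Relation.Nullary using (¬_; yes; no)

open Equivalence using (to; from)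

Π-cong-⇔ : {A : Set} {P Q : A → Set} → (∀ a → P a ⇔ Q a) → ((a : A) → P a) ⇔ ((a : A) → Q a)
Π-cong-⇔ P⇔Q = mk⇔ (λ p a → to (P⇔Q a) (p a)) (λ q a → from (P⇔Q a) (q a))

Σ-cong-⇔ : {A : Set} {P Q : A → Set} → (∀ a → P a ⇔ Q a) → Σ A P ⇔ Σ A Q
Σ-cong-⇔ P⇔Q = Σ-⇔ (↠-id _) (λ {a} → P⇔Q a)

module _ where
  open Nat using (_+_; _*_; _≤_; _<_)

  double-injective : ∀ m n → m + m ≡ n + n → m ≡ n
  double-injective zero    zero    _  = refl
  double-injective (suc m) (suc n) eq =
    cong suc (double-injective m n (suc-injective (begin
      suc (m + m) ≡⟨ +-suc m m ⟨
      m + suc m   ≡⟨ suc-injective eq ⟩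
      n + suc n   ≡⟨ +-suc n n ⟩
      suc (n + n) ∎)))
    where open ≡-Reasoning

  double≢double+1 : ∀ m n → m + m ≢ n + n + 1
  double≢double+1 m n eq = even≢odd m n (begin
    2 * m         ≡⟨ cong (m +_) (+-identityʳ m) ⟩
    m + m         ≡⟨ eq ⟩
    n + n + 1     ≡⟨ +-comm (n + n) 1 ⟩
    suc (n + n)   ≡⟨ cong (λ k → suc (n + k)) (+-identityʳ n) ⟨
    suc (2 * n)   ∎)
    where open ≡-Reasoning

  triangle : ℕ → ℕ
  triangle zero    = 0
  triangle (suc d) = suc d + triangle d

  triangle-double : ∀ d → triangle d + triangle d ≡ d * suc d
  triangle-double zero    = refl
  triangle-double (suc d) = begin
    (suc d + triangle d) + (suc d + triangle d) ≡⟨ regroup (triangle d) d ⟩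
    (triangle d + triangle d) + 2 * suc d       ≡⟨ cong (_+ 2 * suc d) (triangle-double d) ⟩
    d * suc d + 2 * suc d                       ≡⟨ next d ⟩
    suc d * suc (suc d)                         ∎
    where
    open ≡-Reasoning
    regroup : ∀ x d → (suc d + x) + (suc d + x) ≡ (x + x) + 2 * suc d
    regroup = solve-∀
    next : ∀ d → d * suc d + 2 * suc d ≡ suc d * suc (suc d)
    next = solve-∀

  pairCode-exists : ∀ s t → Σ ℕ (IsPairCode ℕS s t)
  pairCode-exists s t = triangle (s + t) + t , (begin
    (T + t) + (T + t)               ≡⟨ regroup T t ⟩
    (T + T) + (t + t)               ≡⟨ cong (_+ (t + t)) (triangle-double (s + t)) ⟩
    (s + t) * suc (s + t) + (t + t) ≡⟨ cong (λ k → (s + t) * k + (t + t)) (+-comm 1 (s + t)) ⟩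
    (s + t) * (s + t + 1) + (t + t) ∎)
    where
    T = triangle (s + t)
    open ≡-Reasoning
    regroup : ∀ x t → (x + t) + (x + t) ≡ (x + x) + (t + t)
    regroup = solve-∀

  -- Doubled codes on the diagonal s + t = d lie below all doubled codes on later diagonals.
  pairCode-bound : ∀ {d d' t} → t ≤ d → d < d' → d * (d + 1) + (t + t) < d' * (d' + 1)
  pairCode-bound {d} {d'} {t} t≤d d<d' = begin-strict
    d * (d + 1) + (t + t)     ≤⟨ +-monoʳ-≤ (d * (d + 1)) (+-mono-≤ t≤d t≤d) ⟩
    d * (d + 1) + (d + d)     <⟨ m<m+n _ z<s ⟩
    d * (d + 1) + (d + d) + 2 ≡⟨ square-step d ⟩
    suc d * (suc d + 1)       ≤⟨ *-mono-≤ d<d' (+-monoˡ-≤ 1 d<d') ⟩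
    d' * (d' + 1)             ∎
    where
    open ≤-Reasoning
    square-step : ∀ d → d * (d + 1) + (d + d) + 2 ≡ suc d * (suc d + 1)
    square-step = solve-∀

  pairCode-injective : ∀ {s t s' t' c} → IsPairCode ℕS s t c → IsPairCode ℕS s' t' c →
                       s ≡ s' × t ≡ t'
  pairCode-injective {s} {t} {s'} {t'} e e' with <-cmp (s + t) (s' + t')
  ... | tri< lt _ _ = ⊥-elim (<-irrefl (trans (sym e) e')
          (<-≤-trans (pairCode-bound (m≤n+m t s) lt) (m≤m+n _ _)))
  ... | tri> _ _ gt = ⊥-elim (<-irrefl (trans (sym e') e)
          (<-≤-trans (pairCode-bound (m≤n+m t' s') gt) (m≤m+n _ _)))
  ... | tri≈ _ diag _ = +-cancelʳ-≡ t s s' (trans diag (cong (s' +_) (sym t≡t'))) , t≡t'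
    where
    t≡t' : t ≡ t'
    t≡t' = double-injective t t' (+-cancelˡ-≡ ((s + t) * (s + t + 1)) _ _
             (trans (sym e) (trans e' (cong (λ k → k * (k + 1) + (t' + t')) (sym diag)))))

renameTm : ∀ {k k'} → (Fin k → Fin k') → Tm k → Tm k'
renameTm r (var x) = var (r x)
renameTm r zer     = zer
renameTm r one     = one
renameTm r (s ⊕ t) = renameTm r s ⊕ renameTm r t
renameTm r (s ⊗ t) = renameTm r s ⊗ renameTm r t

rename : ∀ {k k'} → (Fin k → Fin k') → Fm k → Fm k'
rename r (s ≐ t)  = renameTm r s ≐ renameTm r t
rename r (s ≺ t)  = renameTm r s ≺ renameTm r t
rename r ⊥'       = ⊥'
rename r (¬' φ)   = ¬' rename r φ
rename r (φ ∧' ψ) = rename r φ ∧' rename r ψ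
rename r (φ ∨' ψ) = rename r φ ∨' rename r ψ
rename r (φ ⇒' ψ) = rename r φ ⇒' rename r ψ
rename r (∀' φ)   = ∀' (rename (lift 1 r) φ)
rename r (∃' φ)   = ∃' (rename (lift 1 r) φ)

module _ (M : Structure) where

  evalTm-rename : ∀ {k k'} (r : Fin k → Fin k') (t : Tm k) {ρ : Env M k'} {σ : Env M k} →
                  (∀ x → ρ (r x) ≡ σ x) → evalTm M (renameTm r t) ρ ≡ evalTm M t σ
  evalTm-rename r (var x) agree = agree x
  evalTm-rename r zer     agree = refl
  evalTm-rename r one     agree = refl
  evalTm-rename r (s ⊕ t) agree = cong₂ (_+ᴹ_ M) (evalTm-rename r s agree) (evalTm-rename r t agree)
  evalTm-rename r (s ⊗ t) agree = cong₂ (_*ᴹ_ M) (evalTm-rename r s agree) (evalTm-rename r t agree)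

  extend-lift : ∀ {k k'} {r : Fin k → Fin k'} {ρ : Env M k'} {σ : Env M k} →
                (∀ x → ρ (r x) ≡ σ x) → ∀ a x → extend M a ρ (lift 1 r x) ≡ extend M a σ x
  extend-lift agree a Fin.zero    = refl
  extend-lift agree a (Fin.suc x) = agree x

  Sat-rename : ∀ {k k'} (r : Fin k → Fin k') (φ : Fm k) {ρ : Env M k'} {σ : Env M k} →
               (∀ x → ρ (r x) ≡ σ x) → Sat M (rename r φ) ρ ⇔ Sat M φ σ
  Sat-rename r (s ≐ t) agree =
    subst₂ (λ a b → _ ⇔ a ≡ b) (evalTm-rename r s agree) (evalTm-rename r t agree) (⇔-id _)
  Sat-rename r (s ≺ t) agree =
    subst₂ (λ a b → _ ⇔ _<ᴹ_ M a b) (evalTm-rename r s agree) (evalTm-rename r t agree) (⇔-id _)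
  Sat-rename r ⊥'       agree = ⇔-id _
  Sat-rename r (¬' φ)   agree = ¬-cong-⇔ (Sat-rename r φ agree)
  Sat-rename r (φ ∧' ψ) agree = Sat-rename r φ agree ×-⇔ Sat-rename r ψ agree
  Sat-rename r (φ ∨' ψ) agree = Sat-rename r φ agree ⊎-⇔ Sat-rename r ψ agree
  Sat-rename r (φ ⇒' ψ) agree = →-cong-⇔ (Sat-rename r φ agree) (Sat-rename r ψ agree)
  Sat-rename r (∀' φ)   agree = Π-cong-⇔ λ a → Sat-rename (lift 1 r) φ (extend-lift agree a)
  Sat-rename r (∃' φ)   agree = Σ-cong-⇔ λ a → Sat-rename (lift 1 r) φ (extend-lift agree a)

PairCodeF : ∀ {k} → Tm k → Tm k → Tm k → Fm k
PairCodeF s t c = (c ⊕ c) ≐ (((s ⊕ t) ⊗ ((s ⊕ t) ⊕ one)) ⊕ (t ⊕ t))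

SignSplitF : ∀ {k} → Fin k → Fin k → Fin k → Fm k
SignSplitF s p q =
  ((var s ≐ (var p ⊕ var p)) ∧' (var q ≐ zer)) ∨'
  ∃' ((var (Fin.suc s) ≐ ((a ⊕ a) ⊕ one)) ∧' ((var (Fin.suc p) ≐ zer) ∧' (var (Fin.suc q) ≐ (a ⊕ one))))
  where a = var (# 0)

FractionF : ∀ {k} → Fin k → Fin k → Fin k → Fin k → Fm k
FractionF j p q t = ∃' (PairCodeF (var (# 0)) (var (Fin.suc t)) (var (Fin.suc j)) ∧'
                        SignSplitF (# 0) (Fin.suc p) (Fin.suc q))

CodesFractionF : ∀ {k} → Fin k → Fm k
CodesFractionF j = ∃' (∃' (∃' ((¬' (var (# 0) ≐ zer)) ∧' FractionF (3 ↑ʳ j) (# 2) (# 1) (# 0))))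

CloseF : ∀ {k} → Fin k → Fin k → Fin k → Fin k → Fin k → Fin k → Fin k → Fm k
CloseF m p₁ q₁ t₁ p₂ q₂ t₂ =
  ((var m ⊗ U) ≺ ((var m ⊗ V) ⊕ (var t₁ ⊗ var t₂))) ∧' ((var m ⊗ V) ≺ ((var m ⊗ U) ⊕ (var t₁ ⊗ var t₂)))
  where U = (var p₁ ⊗ var t₂) ⊕ (var q₂ ⊗ var t₁)
        V = (var p₂ ⊗ var t₁) ⊕ (var q₁ ⊗ var t₂)

IfF : ∀ {k} → Fm k → Fm k → Fm k → Fm k
IfF ψ φ δ = (ψ ∧' φ) ∨' ((¬' ψ) ∧' δ)

module _ (M : Structure) {k : ℕ} (ψ φ δ : Fm k) {ρ : Env M k} where

  sat-IfF-holds : Sat M ψ ρ → Sat M (IfF ψ φ δ) ρ ⇔ Sat M φ ρ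
  sat-IfF-holds holds = mk⇔
    (λ { (inj₁ (_ , sφ)) → sφ ; (inj₂ (fails , _)) → ⊥-elim (fails holds) })
    (λ sφ → inj₁ (holds , sφ))

  sat-IfF-fails : ¬ Sat M ψ ρ → Sat M (IfF ψ φ δ) ρ ⇔ Sat M δ ρ
  sat-IfF-fails fails = mk⇔
    (λ { (inj₁ (holds , _)) → ⊥-elim (fails holds) ; (inj₂ (_ , sδ)) → sδ })
    (λ sδ → inj₂ (fails , sδ))

module _ (M : Structure) where
  private
    C = Carrier M
    _+_ = _+ᴹ_ M
    _*_ = _*ᴹ_ M
    _<_ = _<ᴹ_ M
  infixl 6 _+_
  infixl 7 _*_
  infix 4 _<_

  -- s is the code (in the sense of intCode) of the integer p − q, where p = 0 or q = 0.
  SignSplit : C → C → C → Set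
  SignSplit s p q = (s ≡ p + p × q ≡ 𝟘 M)
                  ⊎ Σ C λ a → s ≡ a + a + 𝟙 M × (p ≡ 𝟘 M × q ≡ a + 𝟙 M)

  FractionCode : C → C → C → C → Set
  FractionCode j p q t = Σ C λ s → IsPairCode M s t j × SignSplit s p q

  CodesFraction : C → Set
  CodesFraction j = Σ C λ p → Σ C λ q → Σ C λ t → t ≢ 𝟘 M × FractionCode j p q t

  CloseParts : C → C → C → C → C → C → C → Set
  CloseParts m p₁ q₁ t₁ p₂ q₂ t₂ =
    let U = p₁ * t₂ + q₂ * t₁
        V = p₂ * t₁ + q₁ * t₂
    in (m * U < m * V + t₁ * t₂) × (m * V < m * U + t₁ * t₂)

  CloseCodes : C → C → C → Set
  CloseCodes m j₁ j₂ = Σ C λ p₁ → Σ C λ q₁ → Σ C λ t₁ → Σ C λ p₂ → Σ C λ q₂ → Σ C λ t₂ →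
    FractionCode j₁ p₁ q₁ t₁ × FractionCode j₂ p₂ q₂ t₂ × CloseParts m p₁ q₁ t₁ p₂ q₂ t₂

  signSplit-intCode : (a : MInt C) → SignSplit (intCode M a) (pp M a) (np M a)
  signSplit-intCode (pos a)    = inj₁ (refl , refl)
  signSplit-intCode (negsuc a) = inj₂ (a , refl , refl , refl)

  signSplit⇒MInt : ∀ {s p q} → SignSplit s p q →
                   Σ (MInt C) λ a → intCode M a ≡ s × pp M a ≡ p × np M a ≡ q
  signSplit⇒MInt {p = p} (inj₁ (s≡p+p , q≡0))       = pos p , sym s≡p+p , refl , sym q≡0
  signSplit⇒MInt (inj₂ (a , s≡2a+1 , p≡0 , q≡a+1)) = negsuc a , sym s≡2a+1 , sym p≡0 , sym q≡a+1

  fractionCode-of : ∀ a b {j} → CodeOf M (a , b) j → FractionCode j (pp M a) (np M a) b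
  fractionCode-of a b c = intCode M a , c , signSplit-intCode a

  codesFraction⇔ : ∀ j → CodesFraction j ⇔ Σ (MInt C × C) λ e → proj₂ e ≢ 𝟘 M × CodeOf M e j
  codesFraction⇔ j = mk⇔ decode encode
    where
    decode : CodesFraction j → Σ (MInt C × C) λ e → proj₂ e ≢ 𝟘 M × CodeOf M e j
    decode (p , q , t , t≢0 , s , c , split) with signSplit⇒MInt split
    ... | a , refl , _ = (a , t) , t≢0 , c
    encode : (Σ (MInt C × C) λ e → proj₂ e ≢ 𝟘 M × CodeOf M e j) → CodesFraction j
    encode ((a , b) , b≢0 , c) = pp M a , np M a , b , b≢0 , fractionCode-of a b c

  closeCodes-of : ∀ {m} e₁ e₂ {j₁ j₂} → Close M m e₁ e₂ → CodeOf M e₁ j₁ → CodeOf M e₂ j₂ →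
                  CloseCodes m j₁ j₂
  closeCodes-of (a₁ , b₁) (a₂ , b₂) close c₁ c₂ =
    pp M a₁ , np M a₁ , b₁ , pp M a₂ , np M a₂ , b₂ ,
    fractionCode-of a₁ b₁ c₁ , fractionCode-of a₂ b₂ c₂ , close

  code-unique : (∀ a b → a + a ≡ b + b → a ≡ b) →
                ∀ e {j j'} → CodeOf M e j → CodeOf M e j' → j ≡ j'
  code-unique double-inj e c c' = double-inj _ _ (trans c (sym c'))

  Represents : (C → C → Set) → Seq M → Set
  Represents R x = ∀ i j → R i j ⇔ CodeOf M (x i) j

  -- M-reals seen through the relation R i j := "j codes the i-th term".
  module _ (R : C → C → Set) where

    TotalOnFractions : Set
    TotalOnFractions = ∀ i → Σ C λ j → R i j × CodesFraction j

    Functional : Set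
    Functional = ∀ i j j' → R i j → R i j' → j ≡ j'

    ConvergentOnCodes : Set
    ConvergentOnCodes = ∀ m → 𝟘 M < m → Σ C λ n → ∀ k₁ k₂ → n < k₁ → n < k₂ →
      ∀ j₁ j₂ → R k₁ j₁ → R k₂ j₂ → CloseCodes m j₁ j₂

    CodesMReal : Set
    CodesMReal = TotalOnFractions × Functional × ConvergentOnCodes

  pairing-total : ModelOfTA M → ∀ s t → Σ C (IsPairCode M s t)
  pairing-total ta = ta (∀' (∀' (∃' (PairCodeF (var (# 2)) (var (# 1)) (var (# 0)))))) pairCode-exists

  double-injective-in : ModelOfTA M → ∀ a b → a + a ≡ b + b → a ≡ b
  double-injective-in ta =
    ta (∀' (∀' (((var (# 1) ⊕ var (# 1)) ≐ (var (# 0) ⊕ var (# 0))) ⇒' (var (# 1) ≐ var (# 0)))))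
       double-injective

  codesMReal-of : ModelOfTA M → (x : Seq M) → NonzeroDen M x → Convergent M x →
                  {R : C → C → Set} → Represents R x → CodesMReal R
  codesMReal-of ta x nonzero convergent {R} rep = total , functional , converges
    where
    total : TotalOnFractions R
    total i = let (j , c) = pairing-total ta (intCode M (proj₁ (x i))) (proj₂ (x i))
              in j , from (rep i j) c , from (codesFraction⇔ j) (x i , nonzero i , c)
    functional : Functional R
    functional i j j' r r' =
      code-unique (double-injective-in ta) (x i) (to (rep i j) r) (to (rep i j') r')
    converges : ConvergentOnCodes R
    converges m 0<m = proj₁ (convergent m 0<m) , λ k₁ k₂ n<k₁ n<k₂ j₁ j₂ r₁ r₂ →
      closeCodes-of (x k₁) (x k₂) (proj₂ (convergent m 0<m) k₁ k₂ n<k₁ n<k₂)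
                    (to (rep k₁ j₁) r₁) (to (rep k₂ j₂) r₂)

module _ where
  open Nat using (_+_)

  signSplit-unique : ∀ {s p q p' q'} → SignSplit ℕS s p q → SignSplit ℕS s p' q' → p ≡ p' × q ≡ q'
  signSplit-unique {p = p} {p' = p'} (inj₁ (e , q≡0)) (inj₁ (e' , q'≡0)) =
    double-injective p p' (trans (sym e) e') , trans q≡0 (sym q'≡0)
  signSplit-unique {p = p} (inj₁ (e , _)) (inj₂ (a , e' , _)) =
    ⊥-elim (double≢double+1 p a (trans (sym e) e'))
  signSplit-unique {p' = p'} (inj₂ (a , e , _)) (inj₁ (e' , _)) =
    ⊥-elim (double≢double+1 p' a (trans (sym e') e))
  signSplit-unique (inj₂ (a , e , p≡0 , q≡a+1)) (inj₂ (a' , e' , p'≡0 , q'≡a'+1)) =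
    trans p≡0 (sym p'≡0) , trans q≡a+1 (trans (cong (_+ 1) a≡a') (sym q'≡a'+1))
    where a≡a' = double-injective a a' (+-cancelʳ-≡ 1 (a + a) (a' + a') (trans (sym e) e'))

  fractionCode-unique : ∀ {j p q t p' q' t'} → FractionCode ℕS j p q t → FractionCode ℕS j p' q' t' →
                        p ≡ p' × q ≡ q' × t ≡ t'
  fractionCode-unique {j} {t = t} {t' = t'} (s , c , split) (s' , c' , split')
    with pairCode-injective {s} {t} {s'} {t'} {j} c c'
  ... | refl , t≡t' = let (p≡p' , q≡q') = signSplit-unique split split' in p≡p' , q≡q' , t≡t'

  closeCodes⇒Close : ∀ {m} e₁ e₂ {j₁ j₂} → CloseCodes ℕS m j₁ j₂ →
                     CodeOf ℕS e₁ j₁ → CodeOf ℕS e₂ j₂ → Close ℕS m e₁ e₂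
  closeCodes⇒Close (a₁ , b₁) (a₂ , b₂) {j₁} {j₂} (_ , _ , _ , _ , _ , _ , d₁ , d₂ , close) c₁ c₂
    with fractionCode-unique {j₁} d₁ (fractionCode-of ℕS a₁ b₁ {j₁} c₁)
       | fractionCode-unique {j₂} d₂ (fractionCode-of ℕS a₂ b₂ {j₂} c₂)
  ... | refl , refl , refl | refl , refl , refl = close

  sequence-of-codesMReal : {R : ℕ → ℕ → Set} → CodesMReal ℕS R →
    Σ (Seq ℕS) λ f → Represents ℕS R f × NonzeroDen ℕS f × Convergent ℕS f
  sequence-of-codesMReal {R} (total , functional , convergent) = f , represents , nonzero , converges
    where
    code : ℕ → ℕ
    code i = proj₁ (total i)
    R-code : ∀ i → R i (code i)
    R-code i = proj₁ (proj₂ (total i))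
    entry : ∀ i → Σ (MInt ℕ × ℕ) λ e → proj₂ e ≢ 0 × CodeOf ℕS e (code i)
    entry i = to (codesFraction⇔ ℕS (code i)) (proj₂ (proj₂ (total i)))
    f : Seq ℕS
    f i = proj₁ (entry i)
    f-code : ∀ i → CodeOf ℕS (f i) (code i)
    f-code i = proj₂ (proj₂ (entry i))
    nonzero : NonzeroDen ℕS f
    nonzero i = proj₁ (proj₂ (entry i))
    represents : Represents ℕS R f
    represents i j = mk⇔
      (λ r → subst (CodeOf ℕS (f i)) (functional i (code i) j (R-code i) r) (f-code i))
      (λ c → subst (R i) (code-unique ℕS double-injective (f i) (f-code i) c) (R-code i))
    converges : Convergent ℕS f
    converges m 0<m = proj₁ (convergent m 0<m) , λ k₁ k₂ n<k₁ n<k₂ →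
      closeCodes⇒Close {m} (f k₁) (f k₂) {code k₁} {code k₂}
        (proj₂ (convergent m 0<m) k₁ k₂ n<k₁ n<k₂ (code k₁) (code k₂) (R-code k₁) (R-code k₂))
        (f-code k₁) (f-code k₂)

  constant-integer-convergent : ∀ a → Convergent ℕS (λ _ → a , 1)
  constant-integer-convergent a m _ = 0 , λ _ _ _ _ → m<m+n _ z<s , m<m+n _ z<s

Graph : (M : Structure) {n : ℕ} → Fm (suc (suc n)) → (Fin n → Carrier M) → Carrier M → Carrier M → Set
Graph M φ w i j = Sat M φ (args M w i j)

module SafeVersion {n : ℕ} (φ : Fm (suc (suc n))) where

  placement : (d : ℕ) → Fin (d Nat.+ n) → Fin (d Nat.+ n) → Fin (suc (suc n)) → Fin (d Nat.+ n)
  placement d i j Fin.zero              = i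
  placement d i j (Fin.suc Fin.zero)    = j
  placement d i j (Fin.suc (Fin.suc k)) = d ↑ʳ k

  -- φ(v⃗, i, j) underneath d further binders.
  φ-at : (d : ℕ) → Fin (d Nat.+ n) → Fin (d Nat.+ n) → Fm (d Nat.+ n)
  φ-at d i j = rename (placement d i j) φ

  TotalF : Fm n
  TotalF = ∀' (∃' (φ-at 2 (# 1) (# 0) ∧' CodesFractionF (# 0)))

  FunctionalF : Fm n
  FunctionalF = ∀' (∀' (∀' (φ-at 3 (# 2) (# 1) ⇒' (φ-at 3 (# 2) (# 0) ⇒' (var (# 1) ≐ var (# 0))))))

  -- Variables, innermost first: t₂ q₂ p₂ t₁ q₁ p₁ j₂ j₁ k₂ k₁ n m.
  ConvergentF : Fm n
  ConvergentF = ∀' ((zer ≺ var (# 0)) ⇒' ∃' (∀' (∀' ((var (# 2) ≺ var (# 1)) ⇒' ((var (# 2) ≺ var (# 0)) ⇒'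
    ∀' (∀' (φ-at 6 (# 3) (# 1) ⇒' (φ-at 6 (# 2) (# 0) ⇒'
      ∃' (∃' (∃' (∃' (∃' (∃' (FractionF (# 7) (# 5) (# 4) (# 3) ∧' (FractionF (# 6) (# 2) (# 1) (# 0) ∧'
        CloseF (# 11) (# 5) (# 4) (# 3) (# 2) (# 1) (# 0))))))))))))))))

  CodesMRealF : Fm n
  CodesMRealF = TotalF ∧' (FunctionalF ∧' ConvergentF)

  CodesMRealF-at : Fm (suc (suc n))
  CodesMRealF-at = rename (2 ↑ʳ_) CodesMRealF

  CodesZeroF : Fm (suc (suc n))
  CodesZeroF = PairCodeF (zer ⊕ zer) one (var (# 1))

  safeVersion : Fm (suc (suc n))
  safeVersion = IfF CodesMRealF-at φ CodesZeroF

  module _ (M : Structure) (w : Fin n → Carrier M) where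

    sat-φ-at : ∀ d i j {ρ : Env M (d Nat.+ n)} → (∀ k → ρ (d ↑ʳ k) ≡ w k) →
               Sat M (φ-at d i j) ρ ⇔ Graph M φ w (ρ i) (ρ j)
    sat-φ-at d i j {ρ} ρ-w = Sat-rename M (placement d i j) φ agree
      where
      agree : ∀ x → ρ (placement d i j x) ≡ args M w (ρ i) (ρ j) x
      agree Fin.zero              = refl
      agree (Fin.suc Fin.zero)    = refl
      agree (Fin.suc (Fin.suc k)) = ρ-w k

    sat-CodesMRealF : Sat M CodesMRealF w ⇔ CodesMReal M (Graph M φ w)
    sat-CodesMRealF = sat-TotalF ×-⇔ sat-FunctionalF ×-⇔ sat-ConvergentF
      where
      sat-TotalF : Sat M TotalF w ⇔ TotalOnFractions M (Graph M φ w)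
      sat-TotalF = Π-cong-⇔ λ _ → Σ-cong-⇔ λ _ → sat-φ-at 2 (# 1) (# 0) (λ _ → refl) ×-⇔ ⇔-id _
      sat-FunctionalF : Sat M FunctionalF w ⇔ Functional M (Graph M φ w)
      sat-FunctionalF = Π-cong-⇔ λ _ → Π-cong-⇔ λ _ → Π-cong-⇔ λ _ →
        →-cong-⇔ (sat-φ-at 3 (# 2) (# 1) (λ _ → refl))
                 (→-cong-⇔ (sat-φ-at 3 (# 2) (# 0) (λ _ → refl)) (⇔-id _))
      sat-ConvergentF : Sat M ConvergentF w ⇔ ConvergentOnCodes M (Graph M φ w)
      sat-ConvergentF =
        Π-cong-⇔ λ _ → →-cong-⇔ (⇔-id _) (Σ-cong-⇔ λ _ →
        Π-cong-⇔ λ _ → Π-cong-⇔ λ _ → →-cong-⇔ (⇔-id _) (→-cong-⇔ (⇔-id _) (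
        Π-cong-⇔ λ _ → Π-cong-⇔ λ _ →
          →-cong-⇔ (sat-φ-at 6 (# 3) (# 1) (λ _ → refl))
                   (→-cong-⇔ (sat-φ-at 6 (# 2) (# 0) (λ _ → refl)) (⇔-id _)))))

    sat-CodesMRealF-at : ∀ i j → Sat M CodesMRealF-at (args M w i j) ⇔ CodesMReal M (Graph M φ w)
    sat-CodesMRealF-at i j =
      ⇔-trans (Sat-rename M (2 ↑ʳ_) CodesMRealF {args M w i j} {w} (λ _ → refl)) sat-CodesMRealF

    sat-safeVersion-codesMReal : CodesMReal M (Graph M φ w) →
      ∀ i j → Sat M safeVersion (args M w i j) ⇔ Graph M φ w i j
    sat-safeVersion-codesMReal real i j =
      sat-IfF-holds M CodesMRealF-at φ CodesZeroF (from (sat-CodesMRealF-at i j) real)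

    sat-safeVersion-¬codesMReal : ¬ CodesMReal M (Graph M φ w) →
      Represents M (λ i j → Sat M safeVersion (args M w i j)) (λ _ → pos (𝟘 M) , 𝟙 M)
    sat-safeVersion-¬codesMReal unreal i j =
      sat-IfF-fails M CodesMRealF-at φ CodesZeroF (λ real → unreal (to (sat-CodesMRealF-at i j) real))

  safeVersion-safe : ExcludedMiddle 0ℓ → Safe safeVersion
  safeVersion-safe em v with em {CodesMReal ℕS (Graph ℕS φ v)}
  ... | yes real = let (f , represents , nonzero , converges) = sequence-of-codesMReal real
                   in f , (λ i j → ⇔-trans (sat-safeVersion-codesMReal ℕS v real i j) (represents i j)) ,
                      nonzero , converges
  ... | no unreal = (λ _ → pos 0 , 1) , sat-safeVersion-¬codesMReal ℕS v unreal ,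
                    (λ _ ()) , constant-integer-convergent (pos 0)

mainTheorem7 : ExcludedMiddle 0ℓ → (M : Structure) → ModelOfTA M →
    (x : Seq M) → IsMReal M x →
    Σ ℕ λ n → Σ (Fm (suc (suc n))) λ φ → Safe φ ×
      Σ (Fin n → Carrier M) λ w → Defines M φ w x
mainTheorem7 em M ta x (nonzero , (n , φ , w , defines) , convergent) =
  n , safeVersion , safeVersion-safe em , w ,
  λ i j → ⇔-trans (sat-safeVersion-codesMReal M w real i j) (defines i j)
  where
  open SafeVersion φ
  real : CodesMReal M (Graph M φ w)
  real = codesMReal-of M ta x nonzero convergent defines
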